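{- Let $\mathcal{G}$ be a graph class that contains every complete bipartite graph and is contained in the class of bipartite graphs. Then the lower $\mathcal{G}$ switching class is exactly the class of complete bipartite graphs.
   Context: All graphs are finite and simple. For a graph $G$ and $A\subseteq V(G)$, the switching $S(G,A)$ is the graph on $V(G)$ whose edges are the edges of $G$ with both ends in $A$, the edges of $G$ with both ends outside $A$, and all pairs $uv$ with $u\in A$, $v\notin A$, $uv\notin E(G)$. For a graph class $\mathcal{G}$, the lower $\mathcal{G}$ switching class is the class of graphs $G$ such that $S(G,A)\in\mathcal{G}$ for every $A\subseteq V(G)$. A graph is complete bipartite if its vertex set can be partitioned into two (possibly empty) sets $X,Y$ such that $x$ and $y$ are adjacent for every $x\in X$, $y\in Y$, and there are no other edges. -}

module Defs where

open import Level using (Level; suc)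
open import Data.Nat using (ℕ)
open import Data.Fin using (Fin)
open import Data.Bool using (Bool; true; false; not)
open import Data.Product using (Σ; _×_; _,_; ∃)
open import Relation.Binary.PropositionalEquality using (_≡_; _≢_; refl)
open import Function.Bundles using (_⇔_)

record Graph : Set where
  constructor mkGraph
  field
    n      : ℕ
    adj    : Fin n → Fin n → Bool
    sym    : ∀ u v → adj u v ≡ adj v u
    irrefl : ∀ v → adj v v ≡ false

open Graph public

GraphClass : (ℓ : Level) → Set (Level.suc ℓ)
GraphClass ℓ = Graph → Set ℓ

-- sw a b e: new adjacency of a pair whose ends have A-membership a, b
-- and old adjacency e.  Both ends on the same side: keep e; otherwise flip.
sw : Bool → Bool → Bool → Bool
sw true  true  e = e
sw false false e = e
sw true  false e = not e
sw false true  e = not e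

private
  sw-sym : ∀ a b e → sw a b e ≡ sw b a e
  sw-sym true  true  e = refl
  sw-sym true  false e = refl
  sw-sym false true  e = refl
  sw-sym false false e = refl

  sw-diag : ∀ a → sw a a false ≡ false
  sw-diag true  = refl
  sw-diag false = refl

  sw-adj-sym : (G : Graph) (A : Fin (n G) → Bool) → ∀ u v →
               sw (A u) (A v) (adj G u v) ≡ sw (A v) (A u) (adj G v u)
  sw-adj-sym G A u v rewrite sym G u v = sw-sym (A u) (A v) (adj G v u)

  sw-adj-irr : (G : Graph) (A : Fin (n G) → Bool) → ∀ v →
               sw (A v) (A v) (adj G v v) ≡ false
  sw-adj-irr G A v rewrite irrefl G v = sw-diag (A v)

switch : (G : Graph) → (Fin (n G) → Bool) → Graph
switch G A = mkGraph (n G) (λ u v → sw (A u) (A v) (adj G u v))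
                     (sw-adj-sym G A) (sw-adj-irr G A)

-- Complete bipartite: a partition X (vertices with X v ≡ true) / Y (false),
-- possibly empty parts, with u ~ v iff u and v lie in different parts.
IsCompleteBipartite : Graph → Set
IsCompleteBipartite G =
  Σ (Fin (n G) → Bool) λ X → ∀ u v → (adj G u v ≡ true) ⇔ (X u ≢ X v)

IsBipartite : Graph → Set
IsBipartite G =
  Σ (Fin (n G) → Bool) λ X → ∀ u v → adj G u v ≡ true → X u ≢ X v

LowerSwitching : ∀ {ℓ} → GraphClass ℓ → Graph → Set ℓ
LowerSwitching 𝒢 G = ∀ (A : Fin (n G) → Bool) → 𝒢 (switch G A)

-- G is complete bipartite exactly when adj u v ≡ X u xor X v for some X.  Switching
-- by A adds A u xor A v to every adjacency, so X xor A witnesses that the switched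
-- graph is again complete bipartite.  Conversely, switching by the closed
-- neighbourhood N[u] of a vertex u makes u adjacent to every other vertex; the
-- switched graph is bipartite, hence triangle-free, so no other pair v, w is
-- adjacent in it, which says exactly adj v w ≡ adj u v xor adj u w.  Thus the
-- neighbourhood of u is one side of a complete bipartition of G.
module Submission where

open import Defs hiding (sym)
open import Level using (Level)
open import Algebra using (CommutativeRing)
open import Data.Bool using (Bool; true; false; not; _∨_; _xor_)
open import Data.Bool.Properties
  using (¬-not; true-xor; xor-comm; xor-identityʳ; xor-inverseʳ; xor-∧-commutativeRing)
open import Algebra.Properties.CommutativeSemigroup
  (CommutativeRing.+-commutativeSemigroup xor-∧-commutativeRing) using (interchange)
open import Data.Fin using (Fin; zero)
open import Data.Fin.Properties using (_≟_)
open import Data.Nat using (suc)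
open import Data.Product using (Σ; _,_)
open import Function.Bundles using (_⇔_; mk⇔; Equivalence)
open import Function.Construct.Composition using (_⇔-∘_)
open import Function.Construct.Symmetry using (⇔-sym)
open import Relation.Nullary using (does; yes; no; contradiction)
open import Relation.Nullary.Decidable using (dec-true; dec-false)
open import Relation.Binary.PropositionalEquality
  using (_≡_; _≢_; refl; sym; trans; subst; cong; cong₂; ≢-sym; module ≡-Reasoning)

xor≡true⇔≢ : ∀ x y → (x xor y ≡ true) ⇔ (x ≢ y)
xor≡true⇔≢ true  true  = mk⇔ (λ ()) (λ x≢x → contradiction refl x≢x)
xor≡true⇔≢ true  false = mk⇔ (λ _ ()) (λ _ → refl)
xor≡true⇔≢ false true  = mk⇔ (λ _ ()) (λ _ → refl)
xor≡true⇔≢ false false = mk⇔ (λ ()) (λ x≢x → contradiction refl x≢x)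

≡true⇔≡true⇒≡ : ∀ {x y} → (x ≡ true ⇔ y ≡ true) → x ≡ y
≡true⇔≡true⇒≡ {true}  {true}  _ = refl
≡true⇔≡true⇒≡ {true}  {false} h = sym (Equivalence.to h refl)
≡true⇔≡true⇒≡ {false} {true}  h = Equivalence.from h refl
≡true⇔≡true⇒≡ {false} {false} _ = refl

xor≡false⇒≡ : ∀ x y → x xor y ≡ false → x ≡ y
xor≡false⇒≡ true  true  _ = refl
xor≡false⇒≡ false false _ = refl

≢-≢⇒≡ : ∀ {x y z : Bool} → x ≢ y → x ≢ z → y ≡ z
≢-≢⇒≡ x≢y x≢z = trans (¬-not (≢-sym x≢y)) (sym (¬-not (≢-sym x≢z)))

xor-trueʳ : ∀ x → x xor true ≡ not x
xor-trueʳ x = trans (xor-comm x true) (true-xor x)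

sw-xor : ∀ a b e → sw a b e ≡ e xor (a xor b)
sw-xor true  true  e = sym (xor-identityʳ e)
sw-xor true  false e = sym (xor-trueʳ e)
sw-xor false true  e = sym (xor-trueʳ e)
sw-xor false false e = sym (xor-identityʳ e)

adj-switch : ∀ G A u v → adj (switch G A) u v ≡ adj G u v xor (A u xor A v)
adj-switch G A u v = sw-xor (A u) (A v) (adj G u v)

completeBipartite⇔xor : (G : Graph) →
  IsCompleteBipartite G ⇔ Σ (Fin (n G) → Bool) λ X → ∀ u v → adj G u v ≡ X u xor X v
completeBipartite⇔xor G = mk⇔
  (λ (X , adj⇔≢) → X , λ u v →
    ≡true⇔≡true⇒≡ (⇔-sym (xor≡true⇔≢ (X u) (X v)) ⇔-∘ adj⇔≢ u v))
  (λ (X , adj≡xor) → X , λ u v →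
    subst (λ e → e ≡ true ⇔ X u ≢ X v) (sym (adj≡xor u v)) (xor≡true⇔≢ (X u) (X v)))

switch-completeBipartite : (G : Graph) (A : Fin (n G) → Bool) →
  IsCompleteBipartite G → IsCompleteBipartite (switch G A)
switch-completeBipartite G A cb with Equivalence.to (completeBipartite⇔xor G) cb
... | X , adj≡xor = Equivalence.from (completeBipartite⇔xor (switch G A))
  ((λ x → X x xor A x) , λ u v → begin
    adj (switch G A) u v             ≡⟨ adj-switch G A u v ⟩
    adj G u v xor (A u xor A v)      ≡⟨ cong (_xor (A u xor A v)) (adj≡xor u v) ⟩
    (X u xor X v) xor (A u xor A v)  ≡⟨ interchange (X u) (X v) (A u) (A v) ⟩
    (X u xor A u) xor (X v xor A v)  ∎)
  where open ≡-Reasoning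

TriangleFree : Graph → Set
TriangleFree G = ∀ u v w → adj G u v ≡ true → adj G u w ≡ true → adj G v w ≡ false

bipartite⇒triangleFree : ∀ G → IsBipartite G → TriangleFree G
bipartite⇒triangleFree G (X , edge⇒≢) u v w uv uw =
  ¬-not λ vw → edge⇒≢ v w vw (≢-≢⇒≡ (edge⇒≢ u v uv) (edge⇒≢ u w uw))

closedNeighbourhood : (G : Graph) → Fin (n G) → Fin (n G) → Bool
closedNeighbourhood G u v = does (u ≟ v) ∨ adj G u v

closedNeighbourhood-self : ∀ G u → closedNeighbourhood G u u ≡ true
closedNeighbourhood-self G u = cong (_∨ adj G u u) (dec-true (u ≟ u) refl)

closedNeighbourhood-≢ : ∀ G {u v} → u ≢ v → closedNeighbourhood G u v ≡ adj G u v
closedNeighbourhood-≢ G {u} {v} u≢v = cong (_∨ adj G u v) (dec-false (u ≟ v) u≢v)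

module _ (G : Graph) (u : Fin (n G)) where

  private
    N[u] = closedNeighbourhood G u

  switch-closedNeighbourhood-dominating : ∀ {v} → u ≢ v → adj (switch G N[u]) u v ≡ true
  switch-closedNeighbourhood-dominating {v} u≢v = begin
    adj (switch G N[u]) u v                ≡⟨ adj-switch G N[u] u v ⟩
    adj G u v xor (N[u] u xor N[u] v)      ≡⟨ cong (λ b → adj G u v xor b)
                                                (cong₂ _xor_ (closedNeighbourhood-self G u)
                                                             (closedNeighbourhood-≢ G u≢v)) ⟩
    adj G u v xor not (adj G u v)          ≡⟨ xor-inverseʳ (adj G u v) ⟩
    true                                   ∎
    where open ≡-Reasoning

  switch-closedNeighbourhood-adj : ∀ {v w} → u ≢ v → u ≢ w →
    adj (switch G N[u]) v w ≡ adj G v w xor (adj G u v xor adj G u w)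
  switch-closedNeighbourhood-adj {v} {w} u≢v u≢w =
    trans (adj-switch G N[u] v w)
          (cong (λ b → adj G v w xor b)
                (cong₂ _xor_ (closedNeighbourhood-≢ G u≢v) (closedNeighbourhood-≢ G u≢w)))

  switch-closedNeighbourhood-triangleFree⇒xor : TriangleFree (switch G N[u]) →
    ∀ v w → adj G v w ≡ adj G u v xor adj G u w
  switch-closedNeighbourhood-triangleFree⇒xor triangleFree v w with u ≟ v | u ≟ w
  ... | yes refl | _        rewrite irrefl G u = refl
  ... | no _     | yes refl rewrite irrefl G u | xor-identityʳ (adj G u v) = Graph.sym G v u
  ... | no u≢v   | no u≢w   = xor≡false⇒≡ _ _ (begin
    adj G v w xor (adj G u v xor adj G u w)  ≡⟨ switch-closedNeighbourhood-adj u≢v u≢w ⟨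
    adj (switch G N[u]) v w                  ≡⟨ triangleFree u v w
                                                  (switch-closedNeighbourhood-dominating u≢v)
                                                  (switch-closedNeighbourhood-dominating u≢w) ⟩
    false                                    ∎)
    where open ≡-Reasoning

triangleFreeSwitchings⇒completeBipartite : ∀ G → (∀ A → TriangleFree (switch G A)) →
  IsCompleteBipartite G
triangleFreeSwitchings⇒completeBipartite (mkGraph 0 _ _ _) _ = (λ ()) , λ ()
triangleFreeSwitchings⇒completeBipartite G@(mkGraph (suc _) _ _ _) triangleFree =
  Equivalence.from (completeBipartite⇔xor G)
    (adj G zero , switch-closedNeighbourhood-triangleFree⇒xor G zero
                      (triangleFree (closedNeighbourhood G zero)))

mainTheorem17 : ∀ {ℓ : Level} (𝒢 : GraphClass ℓ) →
                (∀ G → IsCompleteBipartite G → 𝒢 G) →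
                (∀ G → 𝒢 G → IsBipartite G) →
                ∀ (G : Graph) → LowerSwitching 𝒢 G ⇔ IsCompleteBipartite G
mainTheorem17 𝒢 completeBipartite⊆𝒢 𝒢⊆bipartite G = mk⇔
  (λ lower → triangleFreeSwitchings⇒completeBipartite G λ A →
    bipartite⇒triangleFree (switch G A) (𝒢⊆bipartite _ (lower A)))
  (λ cb A → completeBipartite⊆𝒢 _ (switch-completeBipartite G A cb))
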